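{- The natural deduction system for $\mathcal{L}_u$ described below is sound: for every set $\Gamma\cup\{\phi\}$ of $\mathcal{L}_u$-formulas, if $\Gamma\vdash\phi$ then $\Gamma\models\phi$.
   Context: Fix a finite set $\mathbb{P}$ of propositional symbols; a valuation is $v:\mathbb{P}\to\{0,1\}$ with $v(\top)=1,v(\bot)=0$; a team is a set of valuations. $\mathcal{L}_u$: $\phi::=\top\mid\mathsf{x}\subseteqq\mathsf{p}\mid\phi\land\phi\mid\phi\sqcup\phi$, with $\mathsf{x}$ a finite sequence of constants $\top,\bot$, $\mathsf{p}$ a sequence of symbols of $\mathbb{P}$ without repetitions, $|\mathsf{x}|=|\mathsf{p}|$. Semantics: $T\models\top$ always; $T\models\mathsf{x}\subseteqq\mathsf{p}$ iff $T\neq\emptyset$ and for every $v\in T$ there is $v'\in T$ with $v(\mathsf{x})=v'(\mathsf{p})$; $\land$ as usual; $T\models\phi\sqcup\psi$ iff $T\models\phi$ or $T\models\psi$. $\Gamma\models\phi$ iff every team satisfying all of $\Gamma$ satisfies $\phi$. $\Gamma\vdash\phi$ means a natural deduction derivation of $\phi$ with undischarged assumptions in $\Gamma$ using: ($\top$I) infer $\top$; ($\land$I) from $\phi,\psi$ infer $\phi\land\psi$; ($\land$E) from $\phi\land\psi$ infer $\phi$, and $\psi$; ($\sqcup$I) from $\phi$ infer $\phi\sqcup\psi$ and $\psi\sqcup\phi$; ($\sqcup$E) from $\phi\sqcup\psi$ and derivations of $\chi$ from $\phi$ and from $\psi$, infer $\chi$ discharging them; ($\subseteqq$Proj) from $\mathsf{x}y\subseteqq\mathsf{p}q$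 infer $\mathsf{x}\subseteqq\mathsf{p}$; ($\subseteqq$Perm) from $\mathsf{x}\mathsf{y}\mathsf{z}\subseteqq\mathsf{u}\mathsf{v}\mathsf{w}$ infer $\mathsf{x}\mathsf{z}\mathsf{y}\subseteqq\mathsf{u}\mathsf{w}\mathsf{v}$ provided $|\mathsf{y}|=|\mathsf{v}|$, $|\mathsf{z}|=|\mathsf{w}|$; ($\subseteqq$Ext) from $\mathsf{x}\subseteqq\mathsf{p}$ and derivations of $\chi$ from $\mathsf{x}\top\subseteqq\mathsf{p}q$ and from $\mathsf{x}\bot\subseteqq\mathsf{p}q$ ($q$ a symbol not in $\mathsf{p}$), infer $\chi$ discharging them. -}

module Defs where

open import Level using (0ℓ)
open import Data.Nat using (ℕ)
open import Data.Bool using (Bool; true; false)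
open import Data.Fin using (Fin)
open import Data.Vec using (Vec; []; _∷_; _++_; _∷ʳ_; lookup; map)
open import Data.Product using (Σ; ∃; _×_; _,_)
open import Data.Sum using (_⊎_)
open import Relation.Unary using (Pred; _∈_; _∪_; ｛_｝)
open import Relation.Binary.PropositionalEquality using (_≡_; _≢_)

-- The finite set ℙ of propositional symbols is Fin n.
-- The constants ⊤ / ⊥ are represented by the Booleans true / false.

-- valuations v : ℙ → {0,1}; v(⊤) = 1 and v(⊥) = 0 (so v applied to a sequence
-- of constants x is x itself).
Valuation : ℕ → Set
Valuation n = Fin n → Bool

Team : ℕ → Set₁
Team n = Pred (Valuation n) 0ℓ

Distinct : ∀ {n k} → Vec (Fin n) k → Set
Distinct {n} {k} p = ∀ (i j : Fin k) → lookup p i ≡ lookup p j → i ≡ j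

-- Formulas of L_u.  An inclusion atom  x ⊆ p  consists of a sequence x of
-- constants, a sequence p of symbols of the same length k, and a proof that
-- p has no repetitions.
data Formula (n : ℕ) : Set where
  ⊤ᶠ   : Formula n
  incl : ∀ {k} (x : Vec Bool k) (p : Vec (Fin n) k) → Distinct p → Formula n
  _∧ᶠ_ : Formula n → Formula n → Formula n
  _⊔ᶠ_ : Formula n → Formula n → Formula n

_⊨_ : ∀ {n} → Team n → Formula n → Set
T ⊨ ⊤ᶠ = Data.Unit.⊤
  where import Data.Unit
T ⊨ incl x p _ =
  (∃ λ v → v ∈ T) ×
  (∀ v → v ∈ T → ∃ λ v′ → v′ ∈ T × map v′ p ≡ x)
T ⊨ (φ ∧ᶠ ψ) = (T ⊨ φ) × (T ⊨ ψ)
T ⊨ (φ ⊔ᶠ ψ) = (T ⊨ φ) ⊎ (T ⊨ ψ)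

_⊨ᶜ_ : ∀ {n} → Pred (Formula n) 0ℓ → Formula n → Set₁
_⊨ᶜ_ {n} Γ φ = (T : Team n) → (∀ ψ → ψ ∈ Γ → T ⊨ ψ) → T ⊨ φ

-- natural deduction; Γ is the set of (undischarged) assumptions that may be
-- used.  Discharged assumptions are added to the context.
data _⊢_ {n : ℕ} : Pred (Formula n) 0ℓ → Formula n → Set₁ where
  assm : ∀ {Γ φ} → φ ∈ Γ → Γ ⊢ φ
  ⊤I   : ∀ {Γ} → Γ ⊢ ⊤ᶠ
  ∧I   : ∀ {Γ φ ψ} → Γ ⊢ φ → Γ ⊢ ψ → Γ ⊢ (φ ∧ᶠ ψ)
  ∧E₁  : ∀ {Γ φ ψ} → Γ ⊢ (φ ∧ᶠ ψ) → Γ ⊢ φ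
  ∧E₂  : ∀ {Γ φ ψ} → Γ ⊢ (φ ∧ᶠ ψ) → Γ ⊢ ψ
  ⊔I₁  : ∀ {Γ φ} ψ → Γ ⊢ φ → Γ ⊢ (φ ⊔ᶠ ψ)
  ⊔I₂  : ∀ {Γ φ} ψ → Γ ⊢ φ → Γ ⊢ (ψ ⊔ᶠ φ)
  ⊔E   : ∀ {Γ φ ψ χ} → Γ ⊢ (φ ⊔ᶠ ψ) →
         (Γ ∪ ｛ φ ｝) ⊢ χ → (Γ ∪ ｛ ψ ｝) ⊢ χ → Γ ⊢ χ
  ⊆Proj : ∀ {Γ k} {x : Vec Bool k} {y : Bool} {p : Vec (Fin n) k} {q : Fin n}
          {d : Distinct (p ∷ʳ q)} (d′ : Distinct p) →
          Γ ⊢ incl (x ∷ʳ y) (p ∷ʳ q) d → Γ ⊢ incl x p d′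
  ⊆Perm : ∀ {Γ a b c} {x : Vec Bool a} {y : Vec Bool b} {z : Vec Bool c}
          {u : Vec (Fin n) a} {v : Vec (Fin n) b} {w : Vec (Fin n) c}
          {d : Distinct (u ++ v ++ w)} (d′ : Distinct (u ++ w ++ v)) →
          Γ ⊢ incl (x ++ y ++ z) (u ++ v ++ w) d →
          Γ ⊢ incl (x ++ z ++ y) (u ++ w ++ v) d′
  ⊆Ext  : ∀ {Γ k χ} {x : Vec Bool k} {p : Vec (Fin n) k} {d : Distinct p}
          (q : Fin n) → (∀ i → lookup p i ≢ q) →
          (d′ : Distinct (p ∷ʳ q)) →
          Γ ⊢ incl x p d →
          (Γ ∪ ｛ incl (x ∷ʳ true) (p ∷ʳ q) d′ ｝) ⊢ χ →
          (Γ ∪ ｛ incl (x ∷ʳ false) (p ∷ʳ q) d′ ｝) ⊢ χ →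
          Γ ⊢ χ

{-# OPTIONS --safe #-}
module Submission where

-- An inclusion atom x ⊆ p has a constant left-hand side, so its witness v′
-- does not depend on v: T ⊨ x ⊆ p just says that some valuation of T takes
-- the value x on p.  Projection and permutation preserve such a witness, and
-- for extension the witness itself decides which of x⊤ ⊆ pq and x⊥ ⊆ pq
-- holds, namely the one given by its value at q.

open import Defs
open import Level using (0ℓ)
open import Data.Nat using (ℕ)
open import Data.Bool using (Bool; true; false)
open import Data.Fin using (Fin)
open import Data.Vec using (Vec; _++_; _∷ʳ_; map)
open import Data.Vec.Properties using (map-++; map-∷ʳ; ++-injectiveˡ; ++-injectiveʳ; ∷ʳ-injectiveˡ)
open import Data.Product using (Σ; ∃; _×_; _,_; proj₁; proj₂)
open import Data.Sum using (inj₁; inj₂)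
open import Relation.Unary using (Pred; _∈_; _∪_; ｛_｝)
open import Relation.Binary.PropositionalEquality using (_≡_; refl; sym; trans; cong; cong₂; module ≡-Reasoning)

map-∷ʳ-injectiveˡ : ∀ {A B : Set} {k} (f : A → B) (p : Vec A k) (q : A) {x : Vec B k} {y : B} →
                    map f (p ∷ʳ q) ≡ x ∷ʳ y → map f p ≡ x
map-∷ʳ-injectiveˡ f p q {x} eq = ∷ʳ-injectiveˡ (map f p) x (trans (sym (map-∷ʳ f q p)) eq)

map-++-swap : ∀ {A B : Set} {a b c} (f : A → B)
              (u : Vec A a) (v : Vec A b) (w : Vec A c)
              {x : Vec B a} {y : Vec B b} {z : Vec B c} →
              map f (u ++ v ++ w) ≡ x ++ y ++ z → map f (u ++ w ++ v) ≡ x ++ z ++ y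
map-++-swap f u v w {x} {y} {z} eq = begin
  map f (u ++ w ++ v)           ≡⟨ map-++ f u (w ++ v) ⟩
  map f u ++ map f (w ++ v)     ≡⟨ cong (map f u ++_) (map-++ f w v) ⟩
  map f u ++ map f w ++ map f v ≡⟨ cong₂ _++_ fu≡x (cong₂ _++_ fw≡z fv≡y) ⟩
  x ++ z ++ y                   ∎
  where
  open ≡-Reasoning
  split : map f u ++ map f v ++ map f w ≡ x ++ y ++ z
  split = trans (sym (trans (map-++ f u (v ++ w)) (cong (map f u ++_) (map-++ f v w)))) eq
  fu≡x : map f u ≡ x
  fu≡x = ++-injectiveˡ (map f u) x split
  fvw≡yz : map f v ++ map f w ≡ y ++ z
  fvw≡yz = ++-injectiveʳ (map f u) x split
  fv≡y : map f v ≡ y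
  fv≡y = ++-injectiveˡ (map f v) y fvw≡yz
  fw≡z : map f w ≡ z
  fw≡z = ++-injectiveʳ (map f v) y fvw≡yz

_⊨ˢ_ : ∀ {n} → Team n → Pred (Formula n) 0ℓ → Set
T ⊨ˢ Γ = ∀ ψ → ψ ∈ Γ → T ⊨ ψ

⊨ˢ-∪-｛｝ : ∀ {n} {T : Team n} {Γ φ} → T ⊨ˢ Γ → T ⊨ φ → T ⊨ˢ (Γ ∪ ｛ φ ｝)
⊨ˢ-∪-｛｝ T⊨Γ T⊨φ ψ (inj₁ ψ∈Γ) = T⊨Γ ψ ψ∈Γ
⊨ˢ-∪-｛｝ T⊨Γ T⊨φ ψ (inj₂ refl) = T⊨φ

Attains : ∀ {n k} → Team n → Vec (Fin n) k → Vec Bool k → Set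
Attains T p x = ∃ λ v → v ∈ T × map v p ≡ x

module _ {n : ℕ} {T : Team n} where

  -- The proof of distinctness is explicit below: _⊨_ ignores it, so it could
  -- not be inferred.

  incl⇒attains : ∀ {k} {x : Vec Bool k} {p} (d : Distinct p) → T ⊨ incl x p d → Attains T p x
  incl⇒attains _ ((v , v∈T) , witness) = witness v v∈T

  attains⇒incl : ∀ {k} {x : Vec Bool k} {p} (d : Distinct p) → Attains T p x → T ⊨ incl x p d
  attains⇒incl _ (v , v∈T , vp≡x) = (v , v∈T) , λ _ _ → v , v∈T , vp≡x

  incl-transport : ∀ {k l} {x : Vec Bool k} {p} (d : Distinct p)
                   {x′ : Vec Bool l} {p′} (d′ : Distinct p′) →
                   (∀ v → map v p ≡ x → map v p′ ≡ x′) →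
                   T ⊨ incl x p d → T ⊨ incl x′ p′ d′
  incl-transport d d′ f T⊨x⊆p with incl⇒attains d T⊨x⊆p
  ... | v , v∈T , vp≡x = attains⇒incl d′ (v , v∈T , f v vp≡x)

  attains-∷ʳ : ∀ {k} {p : Vec (Fin n) k} {x} (q : Fin n) →
               Attains T p x → Σ Bool λ b → Attains T (p ∷ʳ q) (x ∷ʳ b)
  attains-∷ʳ {p = p} q (v , v∈T , vp≡x) =
    v q , v , v∈T , trans (map-∷ʳ v q p) (cong (_∷ʳ v q) vp≡x)

  sound : ∀ {Γ φ} → Γ ⊢ φ → T ⊨ˢ Γ → T ⊨ φ
  sound (assm φ∈Γ)   T⊨Γ = T⊨Γ _ φ∈Γ
  sound ⊤I           T⊨Γ = _
  sound (∧I d e)     T⊨Γ = sound d T⊨Γ , sound e T⊨Γ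
  sound (∧E₁ d)      T⊨Γ = proj₁ (sound d T⊨Γ)
  sound (∧E₂ d)      T⊨Γ = proj₂ (sound d T⊨Γ)
  sound (⊔I₁ _ d)    T⊨Γ = inj₁ (sound d T⊨Γ)
  sound (⊔I₂ _ d)    T⊨Γ = inj₂ (sound d T⊨Γ)
  sound (⊔E d e f)   T⊨Γ with sound d T⊨Γ
  ... | inj₁ T⊨φ = sound e (⊨ˢ-∪-｛｝ T⊨Γ T⊨φ)
  ... | inj₂ T⊨ψ = sound f (⊨ˢ-∪-｛｝ T⊨Γ T⊨ψ)
  sound (⊆Proj {p = p} {q} {dpq} dp d) T⊨Γ =
    incl-transport dpq dp (λ v → map-∷ʳ-injectiveˡ v p q) (sound d T⊨Γ)
  sound (⊆Perm {x = x} {y} {z} {u} {v} {w} {duvw} duwv d) T⊨Γ =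
    incl-transport duvw duwv (λ val → map-++-swap val u v w {x} {y} {z}) (sound d T⊨Γ)
  sound (⊆Ext {d = dp} q _ dpq d e f) T⊨Γ
    with attains-∷ʳ q (incl⇒attains dp (sound d T⊨Γ))
  ... | true  , a = sound e (⊨ˢ-∪-｛｝ T⊨Γ (attains⇒incl dpq a))
  ... | false , a = sound f (⊨ˢ-∪-｛｝ T⊨Γ (attains⇒incl dpq a))

mainTheorem10 : (n : ℕ) (Γ : Pred (Formula n) 0ℓ) (φ : Formula n) →
    Γ ⊢ φ → Γ ⊨ᶜ φ
mainTheorem10 n Γ φ d T = sound d
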